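{- Let $r$ be a power of $2$ and let $G$ and $P$ be the graph and critical path set defined below. If two distinct critical paths $\pi_1,\pi_2\in P$ correspond to the same value $s\in[r]$ (and hence have distinct starting vertices), then $\pi_1$ and $\pi_2$ are vertex-disjoint.
   Context: For a nonnegative integer $N$, $\langle N\rangle=\{0,\dots,N-1\}$ and $[N]=\{1,\dots,N\}$. Let $r$ be a power of $2$ and let $q$ be the permutation of $\langle r\rangle$ such that the $(\log_2 r)$-bit binary representation of $q_i$ is the $(\log_2 r)$-bit binary representation of $i$ reversed. The directed graph $G$ has vertex set $\{(i,x_1,x_2): i\in\{0,\dots,r\},\ (x_1,x_2)\in\langle 2r\rangle\times\langle 2r^2\rangle\}$ ($i$ is the layer). For $i\in\langle r\rangle$ let $E_i=\{(1,q_i),(0,0)\}$; for every vertex $(i,x_1,x_2)$ with $i<r$ and every $(e_1,e_2)\in E_i$ with $(x_1+e_1,x_2+e_2)\in\langle 2r\rangle\times\langle 2r^2\rangle$ there is an edge from $(i,x_1,x_2)$ to $(i+1,x_1+e_1,x_2+e_2)$; there are no other edges. For each $(x_1,x_2)\in\langle r\rangle\times\langle r^2\rangle$ and each $s\in[r]$ there is a critical path (said to correspond to $s$): it starts at $(0,x_1,x_2)$ and, from layer $i$ to layer $i+1$, uses the edge corresponding to $(1,q_i)$ if $q_i<s$ and the edge corresponding to $(0,0)$ otherwise. $P$ is the set of all these critical paths. -}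

module Defs where

open import Data.Nat using (ℕ; zero; suc; _+_; _*_; _^_; _<ᵇ_)
open import Data.Nat.DivMod using (_/_; _%_)
open import Data.Bool using (if_then_else_)
open import Data.Product using (_×_; _,_)
open import Data.List using (List; []; _∷_)

-- A vertex (i , x₁ , x₂) of G: layer i, coordinates x₁, x₂.
Vertex : Set
Vertex = ℕ × ℕ × ℕ

bitrev : ℕ → ℕ → ℕ
bitrev zero    i = 0
bitrev (suc k) i = (i % 2) * 2 ^ k + bitrev k (i / 2)

q : (k i : ℕ) → ℕ
q k i = bitrev k i

-- Vertex sequence of the walk starting at layer i at (x₁ , x₂), taking
-- `fuel` more steps; from layer j to j+1 it uses the edge (1 , q_j)
-- if q_j < s and the edge (0 , 0) otherwise.
walk : (k s i fuel x₁ x₂ : ℕ) → List Vertex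
walk k s i zero       x₁ x₂ = (i , x₁ , x₂) ∷ []
walk k s i (suc fuel) x₁ x₂ =
  (i , x₁ , x₂) ∷
    (if q k i <ᵇ s
       then walk k s (suc i) fuel (suc x₁) (x₂ + q k i)
       else walk k s (suc i) fuel x₁ x₂)

critPath : (k s x₁ x₂ : ℕ) → List Vertex
critPath k s x₁ x₂ = walk k s 0 (2 ^ k) x₁ x₂

{-# OPTIONS --safe #-}
module Submission where

-- Each step of a walk goes to the next layer, and which edge it takes there
-- depends only on the layer and on s, not on the current position. Hence a
-- vertex shared by two walks with the same s is reached by both after the
-- same steps along the same edges, and undoing these (injective) translations
-- one at a time shows that the two walks started at the same point.

open import Defs
open import Data.Nat using (ℕ; _^_; _*_; _≤_; _<_; zero; suc; _+_; _<ᵇ_)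
open import Data.Nat.Properties using (≤-refl; <⇒≤; n≮n; suc-injective; +-cancelʳ-≡)
open import Data.Bool using (true; false)
open import Data.Empty using (⊥-elim)
open import Data.Product using (_,_; proj₁; proj₂; uncurry)
open import Data.List.Membership.Propositional using (_∈_)
open import Data.List.Relation.Unary.Any using (here; there)
open import Relation.Binary.PropositionalEquality using (_≡_; refl; sym; cong; cong₂)
open import Relation.Nullary using (¬_)

layer : Vertex → ℕ
layer = proj₁

∈-walk⇒layer≥ : ∀ k s i f x₁ x₂ {v} → v ∈ walk k s i f x₁ x₂ → i ≤ layer v
∈-walk⇒layer≥ k s i zero    x₁ x₂ (here refl) = ≤-refl
∈-walk⇒layer≥ k s i (suc f) x₁ x₂ (here refl) = ≤-refl
∈-walk⇒layer≥ k s i (suc f) x₁ x₂ (there v∈) with q k i <ᵇ s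
... | true  = <⇒≤ (∈-walk⇒layer≥ k s (suc i) f (suc x₁) (x₂ + q k i) v∈)
... | false = <⇒≤ (∈-walk⇒layer≥ k s (suc i) f x₁ x₂ v∈)

∈-walk-start-layer : ∀ k s i f x₁ x₂ {y₁ y₂} →
  (i , y₁ , y₂) ∈ walk k s i f x₁ x₂ → (x₁ , x₂) ≡ (y₁ , y₂)
∈-walk-start-layer k s i zero    x₁ x₂ (here refl) = refl
∈-walk-start-layer k s i (suc f) x₁ x₂ (here refl) = refl
∈-walk-start-layer k s i (suc f) x₁ x₂ (there v∈) with q k i <ᵇ s
... | true  = ⊥-elim (n≮n i (∈-walk⇒layer≥ k s (suc i) f (suc x₁) (x₂ + q k i) v∈))
... | false = ⊥-elim (n≮n i (∈-walk⇒layer≥ k s (suc i) f x₁ x₂ v∈))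

translate-injective : ∀ {x₁ x₂ y₁ y₂} c →
  (suc x₁ , x₂ + c) ≡ (suc y₁ , y₂ + c) → (x₁ , x₂) ≡ (y₁ , y₂)
translate-injective {x₂ = x₂} {y₂ = y₂} c e =
  cong₂ _,_ (suc-injective (cong proj₁ e)) (+-cancelʳ-≡ c x₂ y₂ (cong proj₂ e))

walk-start-unique : ∀ k s i f g x₁ x₂ y₁ y₂ {v} →
  v ∈ walk k s i f x₁ x₂ → v ∈ walk k s i g y₁ y₂ → (x₁ , x₂) ≡ (y₁ , y₂)
walk-start-unique k s i zero    g       x₁ x₂ y₁ y₂ (here refl) w∈ =
  sym (∈-walk-start-layer k s i g y₁ y₂ w∈)
walk-start-unique k s i (suc f) g       x₁ x₂ y₁ y₂ (here refl) w∈ =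
  sym (∈-walk-start-layer k s i g y₁ y₂ w∈)
walk-start-unique k s i (suc f) zero    x₁ x₂ y₁ y₂ v∈ (here refl) =
  ∈-walk-start-layer k s i (suc f) x₁ x₂ v∈
walk-start-unique k s i (suc f) (suc g) x₁ x₂ y₁ y₂ v∈@(there _) (here refl) =
  ∈-walk-start-layer k s i (suc f) x₁ x₂ v∈
walk-start-unique k s i (suc f) (suc g) x₁ x₂ y₁ y₂ (there v∈) (there w∈) with q k i <ᵇ s
... | true  = translate-injective (q k i)
                (walk-start-unique k s (suc i) f g (suc x₁) (x₂ + q k i) (suc y₁) (y₂ + q k i) v∈ w∈)
... | false = walk-start-unique k s (suc i) f g x₁ x₂ y₁ y₂ v∈ w∈

lemma4p2 : (k s x₁ x₂ y₁ y₂ : ℕ) →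
    1 ≤ s → s ≤ 2 ^ k →
    x₁ < 2 ^ k → x₂ < 2 ^ k * 2 ^ k →
    y₁ < 2 ^ k → y₂ < 2 ^ k * 2 ^ k →
    ¬ (critPath k s x₁ x₂ ≡ critPath k s y₁ y₂) →
    (v : Vertex) → v ∈ critPath k s x₁ x₂ → ¬ (v ∈ critPath k s y₁ y₂)
-- The range hypotheses only keep the paths inside G; disjointness holds without them.
lemma4p2 k s x₁ x₂ y₁ y₂ _ _ _ _ _ _ distinct v v∈π₁ v∈π₂ =
  distinct (cong (uncurry (critPath k s))
    (walk-start-unique k s 0 (2 ^ k) (2 ^ k) x₁ x₂ y₁ y₂ v∈π₁ v∈π₂))
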